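{- For all implicative-disjunctive formulas $A, B$ and every truth value assignment $V$: $$(\Delta[V;A])^{A} \vdash_{id} (\Delta[V;A \vee B])^{A \vee B} \quad\text{and}\quad (\Delta[V;A])^{A} \vdash_{id} (\Delta[V;B \vee A])^{B \vee A}.$$
   Context: **Language.** Formulas are built from the atomic formulas $p_1, p_2, \dots$ using the binary connectives $\to$, $\vee$ and $\&$. Implicative-disjunctive formulas are those without $\&$. Iterated connectives associate to the right. All formulas are arranged in a fixed decidable linear order $R$. **Semantics.** A truth value assignment $V$ maps formulas to $\{T,F\}$ according to the classical truth conditions. **Notation.** - $\Delta[V;A]$ is the set of atomic subformulas $C$ of $A$ with $V(C)=F$. - For a finite set $K$ of formulas with distinct elements $B_1, \dots, B_n$ listed in the order $R$, $(K)^{A}$ is $A$ if $K$ is empty, and $B_1 \vee \dots \vee B_n \vee A$ (that is, $B_1 \vee (\dots \vee (B_n \vee A))$) otherwise. **Calculus.** $\vdash_{id}$ denotes derivability in the classical implicative-disjunctive propositional calculus. Its axiom schemes are: - $A \to B \to A$; - $(A \to B \to C) \to (A \to B) \to A \to C$; - $((A \to B) \to A) \to A$; - $A \to (A \vee B)$; - $A \to (B \vee A)$; - $(A \to C) \to (B \to C) \to (A \vee B) \to C$. Its only rule is modus ponens. -}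

module Defs where

open import Data.Nat using (ℕ)
open import Data.Bool using (Bool; true; false; _∧_; _∨_; not)
open import Data.List using (List; []; _∷_; foldr)
open import Data.List.Membership.Propositional using (_∈_)
open import Data.List.Relation.Unary.Linked using (Linked)
open import Data.Product using (_×_; ∃)
open import Function.Bundles using (_⇔_)
open import Relation.Binary.PropositionalEquality using (_≡_)
open import Relation.Binary.Structures using (IsStrictTotalOrder)
open import Level using (0ℓ; suc)

infixr 5 _⇒_
infixr 6 _∨'_
infixr 7 _&_

data Formula : Set where
  atom : ℕ → Formula
  _⇒_  : Formula → Formula → Formula
  _∨'_ : Formula → Formula → Formula
  _&_  : Formula → Formula → Formula

-- Implicative-disjunctive formulas: no &.
data IsID : Formula → Set where
  atom : ∀ n → IsID (atom n)
  imp  : ∀ {A B} → IsID A → IsID B → IsID (A ⇒ B)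
  dis  : ∀ {A B} → IsID A → IsID B → IsID (A ∨' B)

-- Truth value assignments: determined by their values on atoms
-- (true = T, false = F), extended by the classical truth conditions.
Assignment : Set
Assignment = ℕ → Bool

eval : Assignment → Formula → Bool
eval V (atom n) = V n
eval V (A ⇒ B)  = not (eval V A) ∨ eval V B
eval V (A ∨' B) = eval V A ∨ eval V B
eval V (A & B)  = eval V A ∧ eval V B

data OccursIn (n : ℕ) : Formula → Set where
  here : OccursIn n (atom n)
  ⇒ˡ   : ∀ {A B} → OccursIn n A → OccursIn n (A ⇒ B)
  ⇒ʳ   : ∀ {A B} → OccursIn n B → OccursIn n (A ⇒ B)
  ∨ˡ   : ∀ {A B} → OccursIn n A → OccursIn n (A ∨' B)
  ∨ʳ   : ∀ {A B} → OccursIn n B → OccursIn n (A ∨' B)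
  &ˡ   : ∀ {A B} → OccursIn n A → OccursIn n (A & B)
  &ʳ   : ∀ {A B} → OccursIn n B → OccursIn n (A & B)

-- Δ[V;A] as a set (predicate) of formulas: the atomic subformulas C of A
-- with V(C) = F.
Δ : Assignment → Formula → Formula → Set
Δ V A C = ∃ λ n → (C ≡ atom n) × OccursIn n A × (eval V C ≡ false)

-- L lists the distinct elements of the set K in the order R
-- (strictly increasing w.r.t. R, and with exactly the members of K).
ListsInOrder : (Formula → Formula → Set) → (Formula → Set) → List Formula → Set
ListsInOrder R K L = Linked R L × (∀ C → (C ∈ L) ⇔ K C)

-- (K)^A for K listed by L: B₁ ∨ (… ∨ (Bₙ ∨ A)), and A if L is empty.
disjTo : List Formula → Formula → Formula
disjTo L A = foldr _∨'_ A L

-- Derivability from hypotheses Γ in the classical implicative-disjunctive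
-- calculus (axiom instances are implicative-disjunctive formulas; rule MP).
infix 3 _⊢id_
data _⊢id_ (Γ : List Formula) : Formula → Set where
  hyp : ∀ {A} → A ∈ Γ → Γ ⊢id A
  ax1 : ∀ {A B} → IsID A → IsID B → Γ ⊢id A ⇒ B ⇒ A
  ax2 : ∀ {A B C} → IsID A → IsID B → IsID C →
        Γ ⊢id (A ⇒ B ⇒ C) ⇒ (A ⇒ B) ⇒ A ⇒ C
  ax3 : ∀ {A B} → IsID A → IsID B → Γ ⊢id ((A ⇒ B) ⇒ A) ⇒ A
  ax4 : ∀ {A B} → IsID A → IsID B → Γ ⊢id A ⇒ (A ∨' B)
  ax5 : ∀ {A B} → IsID A → IsID B → Γ ⊢id A ⇒ (B ∨' A)
  ax6 : ∀ {A B C} → IsID A → IsID B → IsID C →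
        Γ ⊢id (A ⇒ C) ⇒ (B ⇒ C) ⇒ (A ∨' B) ⇒ C
  mp  : ∀ {A B} → Γ ⊢id A ⇒ B → Γ ⊢id A → Γ ⊢id B

-- Every disjunct of (Δ[V;A])^A implies (Δ[V;A ∨ B])^(A ∨ B): each atom of Δ[V;A] is also in
-- Δ[V;A ∨ B] and so is a disjunct of the target, while the final disjunct A implies A ∨ B,
-- which is the target's last disjunct. Axiom 6 assembles these implications by induction on
-- the list of atoms.
module Submission where

open import Defs
open import Data.List using (List; [_]; []; _∷_)
open import Data.List.Membership.Propositional using (_∈_)
open import Data.List.Relation.Binary.Subset.Propositional using (_⊆_)
open import Data.List.Relation.Unary.All as All using (All; []; _∷_)
open import Data.List.Relation.Unary.Any using (here; there)
open import Data.Product using (_×_; _,_)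
open import Function.Bundles using (Equivalence)
open import Relation.Binary.PropositionalEquality using (_≡_; refl)
open import Relation.Binary.Structures using (IsStrictTotalOrder)

disjTo-isID : ∀ {L Y} → All IsID L → IsID Y → IsID (disjTo L Y)
disjTo-isID []       y = y
disjTo-isID (c ∷ cs) y = dis c (disjTo-isID cs y)

module _ {Γ : List Formula} where

  ⇒-trans : ∀ {X Y Z} → IsID X → IsID Y → IsID Z →
            Γ ⊢id X ⇒ Y → Γ ⊢id Y ⇒ Z → Γ ⊢id X ⇒ Z
  ⇒-trans x y z p q = mp (mp (ax2 x y z) (mp (ax1 (imp y z) x) q)) p

  ⇒-∨ʳ : ∀ {X Y Z} → IsID X → IsID Y → IsID Z →
         Γ ⊢id X ⇒ Z → Γ ⊢id X ⇒ (Y ∨' Z)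
  ⇒-∨ʳ x y z p = ⇒-trans x z (dis y z) p (ax5 z y)

  ⇒-disjTo : ∀ {L X Y} → All IsID L → IsID X → IsID Y →
             Γ ⊢id X ⇒ Y → Γ ⊢id X ⇒ disjTo L Y
  ⇒-disjTo []       x y p = p
  ⇒-disjTo (c ∷ cs) x y p =
    ⇒-∨ʳ x c (disjTo-isID cs y) (⇒-disjTo cs x y p)

  ∈⇒disjTo : ∀ {L Y C} → All IsID L → IsID Y → C ∈ L → Γ ⊢id C ⇒ disjTo L Y
  ∈⇒disjTo (c ∷ cs) y (here refl) = ax4 c (disjTo-isID cs y)
  ∈⇒disjTo (c ∷ cs) y (there m)   =
    ⇒-∨ʳ (All.lookup cs m) c (disjTo-isID cs y) (∈⇒disjTo cs y m)

  disjTo-⊆ : ∀ {L₁ L₂ X Y} → All IsID L₁ → All IsID L₂ → IsID X → IsID Y →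
             L₁ ⊆ L₂ → Γ ⊢id X ⇒ disjTo L₂ Y → Γ ⊢id disjTo L₁ X ⇒ disjTo L₂ Y
  disjTo-⊆ []       ids₂ x y sub p = p
  disjTo-⊆ (c ∷ cs) ids₂ x y sub p =
    mp (mp (ax6 c (disjTo-isID cs x) (disjTo-isID ids₂ y))
           (∈⇒disjTo ids₂ y (sub (here refl))))
       (disjTo-⊆ cs ids₂ x y (λ m → sub (there m)) p)

module _ {R : Formula → Formula → Set} {V : Assignment} where

  ListsInOrder-Δ-isID : ∀ {A L} → ListsInOrder R (Δ V A) L → All IsID L
  ListsInOrder-Δ-isID (_ , lists) =
    All.tabulate λ {C} m → atomIsID (Equivalence.to (lists C) m)
    where
    atomIsID : ∀ {A C} → Δ V A C → IsID C
    atomIsID (n , refl , _) = atom n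

  ListsInOrder-Δ-⊆ : ∀ {A A′ L L′} → (∀ {n} → OccursIn n A → OccursIn n A′) →
                     ListsInOrder R (Δ V A) L → ListsInOrder R (Δ V A′) L′ → L ⊆ L′
  ListsInOrder-Δ-⊆ occ (_ , lists) (_ , lists′) {C} m
    with Equivalence.to (lists C) m
  ... | n , C≡n , o , f = Equivalence.from (lists′ C) (n , C≡n , occ o , f)

  disjTo-Δ-mono : ∀ {Γ A A′ L L′} → IsID A → IsID A′ →
                  (∀ {n} → OccursIn n A → OccursIn n A′) →
                  ListsInOrder R (Δ V A) L → ListsInOrder R (Δ V A′) L′ →
                  Γ ⊢id A ⇒ A′ → Γ ⊢id disjTo L A → Γ ⊢id disjTo L′ A′
  disjTo-Δ-mono {L′ = L′} a a′ occ lists lists′ A⇒A′ =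
    mp (disjTo-⊆ (ListsInOrder-Δ-isID lists) ids′ a a′
                 (ListsInOrder-Δ-⊆ occ lists lists′) (⇒-disjTo ids′ a a′ A⇒A′))
    where
    ids′ : All IsID L′
    ids′ = ListsInOrder-Δ-isID lists′

mainTheorem15 : (R : Formula → Formula → Set) → IsStrictTotalOrder _≡_ R →
    (A B : Formula) → IsID A → IsID B → (V : Assignment) →
    (LA LAB LBA : List Formula) →
    ListsInOrder R (Δ V A) LA →
    ListsInOrder R (Δ V (A ∨' B)) LAB →
    ListsInOrder R (Δ V (B ∨' A)) LBA →
    ([ disjTo LA A ] ⊢id disjTo LAB (A ∨' B))
      × ([ disjTo LA A ] ⊢id disjTo LBA (B ∨' A))
mainTheorem15 R _ A B a b V LA LAB LBA listsA listsAB listsBA =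
    disjTo-Δ-mono a (dis a b) ∨ˡ listsA listsAB (ax4 a b) premise
  , disjTo-Δ-mono a (dis b a) ∨ʳ listsA listsBA (ax5 a b) premise
  where
  premise : [ disjTo LA A ] ⊢id disjTo LA A
  premise = hyp (here refl)
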